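{- Let $D$ be a bipartite graph with $D\in\mathcal{U}$. Then $D$ has a perfect matching.
   Context: A graph is a symmetric digraph. $D\in\mathcal{U}$ means there is a unitary matrix $U$, indexed by the vertices, with $U_{v,w}\neq0$ iff $(v,w)$ is an arc. A perfect matching of a graph on $n$ vertices is a set of $n/2$ pairwise vertex-disjoint edges. -}

module Defs where

open import Level using (0ℓ)
open import Data.Nat using (ℕ; zero; suc) renaming (_*_ to _*ℕ_)
open import Data.Fin using (Fin; zero; suc; _≟_)
open import Relation.Nullary using (yes; no)
open import Data.Bool using (Bool; true; false)
open import Data.Sum using (_⊎_)
open import Data.Product using (_×_; _,_; proj₁; proj₂; Σ; ∃; ∃-syntax)
open import Relation.Nullary using (¬_)
open import Relation.Binary.PropositionalEquality using (_≡_; _≢_)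
open import Algebra.Bundles using (CommutativeRing)

-- The real numbers, axiomatised as a complete ordered field.
-- (Any two models are isomorphic, so quantifying over all models is
-- the same as speaking about ℝ.)

record RealField : Set₁ where
  infix 4 _≤_
  field
    commRing : CommutativeRing 0ℓ 0ℓ
  open CommutativeRing commRing public
    using (Carrier; _≈_; _+_; _*_; -_; _-_; 0#; 1#; isCommutativeRing; setoid)
  field
    inv        : Carrier → Carrier
    inv-inverse : ∀ x → ¬ (x ≈ 0#) → (x * inv x) ≈ 1#
    0≉1        : ¬ (0# ≈ 1#)
    _≤_        : Carrier → Carrier → Set
    ≤-reflexive : ∀ {x y} → x ≈ y → x ≤ y
    ≤-antisym  : ∀ {x y} → x ≤ y → y ≤ x → x ≈ y
    ≤-trans    : ∀ {x y z} → x ≤ y → y ≤ z → x ≤ z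
    ≤-total    : ∀ x y → (x ≤ y) ⊎ (y ≤ x)
    +-mono-≤   : ∀ {x y} z → x ≤ y → (x + z) ≤ (y + z)
    *-nonneg   : ∀ {x y} → 0# ≤ x → 0# ≤ y → 0# ≤ (x * y)
    sup : (P : Carrier → Set) → ∃[ a ] P a → ∃[ b ] (∀ a → P a → a ≤ b) →
          ∃[ s ] ((∀ a → P a → a ≤ s) × (∀ b → (∀ a → P a → a ≤ b) → s ≤ b))

module Complex (ℝ : RealField) where
  open RealField ℝ

  ℂ : Set
  ℂ = Carrier × Carrier

  _≈ℂ_ : ℂ → ℂ → Set
  (a , b) ≈ℂ (c , d) = (a ≈ c) × (b ≈ d)

  0ℂ 1ℂ : ℂ
  0ℂ = 0# , 0#
  1ℂ = 1# , 0#

  _+ℂ_ _*ℂ_ : ℂ → ℂ → ℂ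
  (a , b) +ℂ (c , d) = (a + c) , (b + d)
  (a , b) *ℂ (c , d) = ((a * c) - (b * d)) , ((a * d) + (b * c))

  conj : ℂ → ℂ
  conj (a , b) = a , (- b)

  sumℂ : (n : ℕ) → (Fin n → ℂ) → ℂ
  sumℂ zero    f = 0ℂ
  sumℂ (suc n) f = f zero +ℂ sumℂ n (λ k → f (suc k))

  Matrix : ℕ → Set
  Matrix n = Fin n → Fin n → ℂ

  _† : ∀ {n} → Matrix n → Matrix n
  (U †) v w = conj (U w v)

  _·_ : ∀ {n} → Matrix n → Matrix n → Matrix n
  _·_ {n} A B v w = sumℂ n (λ k → A v k *ℂ B k w)

  I : ∀ {n} → Matrix n
  I v w with v ≟ w
  ... | yes _ = 1ℂ
  ... | no  _ = 0ℂ

  _≈M_ : ∀ {n} → Matrix n → Matrix n → Set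
  A ≈M B = ∀ v w → A v w ≈ℂ B v w

  IsUnitary : ∀ {n} → Matrix n → Set
  IsUnitary U = ((U · (U †)) ≈M I) × (((U †) · U) ≈M I)

Digraph : ℕ → Set
Digraph n = Fin n → Fin n → Bool

Arc : ∀ {n} → Digraph n → Fin n → Fin n → Set
Arc D v w = D v w ≡ true

-- a graph = a symmetric digraph
IsSymmetric : ∀ {n} → Digraph n → Set
IsSymmetric D = ∀ v w → Arc D v w → Arc D w v

IsBipartite : ∀ {n} → Digraph n → Set
IsBipartite {n} D = Σ (Fin n → Bool) λ c → ∀ (v w : Fin n) → Arc D v w → c v ≢ c w

-- D ∈ 𝒰 : some unitary complex matrix U with U v w ≠ 0 iff (v,w) is an arc
InU : (ℝ : RealField) → ∀ {n} → Digraph n → Set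
InU ℝ {n} D = let open Complex ℝ in
  Σ (Matrix n) λ U → (IsUnitary U × (∀ v w → (¬ (U v w ≈ℂ 0ℂ) → Arc D v w) × (Arc D v w → ¬ (U v w ≈ℂ 0ℂ))))

Disjoint : ∀ {n} → Fin n × Fin n → Fin n × Fin n → Set
Disjoint (a , b) (c , d) = (a ≢ c) × (a ≢ d) × (b ≢ c) × (b ≢ d)

HasPerfectMatching : ∀ {n} → Digraph n → Set
HasPerfectMatching {n} D =
  Σ ℕ λ k → (k *ℕ 2 ≡ n × Σ (Fin k → Fin n × Fin n) λ M → (
    (∀ (i : Fin k) → proj₁ (M i) ≢ proj₂ (M i) × Arc D (proj₁ (M i)) (proj₂ (M i))) ×
    (∀ (i j : Fin k) → i ≢ j → Disjoint (M i) (M j))))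

{-# OPTIONS --safe #-}

-- A unitary matrix U supported on the arcs of D yields the doubly stochastic matrix ∣U v w∣²,
-- with the same support. Its rows indexed by a vertex set S carry total mass ∣S∣, all of it
-- inside the columns indexed by the out-neighbourhood N(S), which carry total mass ∣N(S)∣;
-- hence ∣S∣ ≤ ∣N(S)∣. For a bipartite D with colour classes X and Y this gives
-- ∣X∣ ≤ ∣N(X)∣ ≤ ∣Y∣ ≤ ∣N(Y)∣ ≤ ∣X∣, so ∣X∣ = n/2, and Hall's theorem matches X into Y.
--
-- Hall's theorem is proved following Rado. If Hall's condition holds on L and some x ∈ L has two
-- neighbours y₁ ≠ y₂, then it still holds after deleting the arc x → y₁ or the arc x → y₂:
-- violating sets S₁, S₂ for the two deletions would, by submodularity of ∣N(·)∣, force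
-- S₁ ∪ S₂ or (S₁ ∩ S₂) - x to violate it for the original family. Deleting arcs while possible
-- leaves every vertex of L with a single neighbour, and Hall's condition for pairs makes this
-- choice injective.

module Submission where

open import Defs
open import Algebra.Bundles using (CommutativeRing)
open import Data.Bool.Base using (Bool; true; not; if_then_else_)
open import Data.Bool.Properties using (¬-not)
open import Data.Fin.Base using (Fin; zero; suc)
open import Data.Fin.Properties using (any?; _≟_; suc-injective; sequence)
open import Data.Fin.Subset using (Subset; inside; outside; _∈_; _∉_; ∣_∣)
open import Data.Fin.Subset.Properties using (_∈?_)
open import Data.Nat.Base as ℕ using (ℕ; zero; suc; z≤n; s≤s)
import Data.Nat.Properties as ℕₚ
open import Data.Product.Base as Product using (∃; ∃₂; _×_; _,_; proj₁)
open import Data.Sum.Base using (_⊎_; inj₁; inj₂)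
open import Data.Vec.Base using ([]; _∷_; tabulate; here; there)
open import Data.Vec.Functional using (updateAt)
open import Data.Vec.Functional.Properties using (updateAt-updates; updateAt-minimal)
open import Data.Vec.Properties using (lookup∘tabulate; lookup⇒[]=; []=⇒lookup)
open import Effect.Monad using (RawMonad)
open import Function.Base using (_∘_)
open import Induction.WellFounded using (module All)
import Relation.Binary.Construct.On as On
open import Relation.Binary.Bundles using (Preorder)
open import Relation.Binary.Structures using (IsPreorder)
import Relation.Binary.PropositionalEquality as ≡
open import Relation.Nullary.Decidable using (Dec; yes; no; does; proof; _×-dec_; ¬?; dec-true; decidable-stable)
open import Relation.Nullary.Negation using (¬_; contradiction; ¬¬-map; ¬¬-Monad)
open import Relation.Nullary.Reflects using (Reflects; invert)
open import Relation.Unary using (Decidable)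

private
  variable
    n : ℕ
    x y y₁ y₂ v w : Fin n
    A B : Fin n → Subset n
    S T L : Subset n

module DoublyStochastic (ℝ : RealField) where

  open RealField ℝ
  open CommutativeRing commRing
    using (refl; sym; trans; isEquivalence; -‿inverseʳ; *-cong; +-cong; +-congˡ; *-congˡ; -‿cong;
           +-identityˡ; +-comm; *-identityˡ; *-identityʳ; zeroˡ; semiring; ring; +-rawMonoid)
  open import Algebra.Properties.Ring ring using (-‿distribˡ-*; -‿distribʳ-*; -‿involutive; //-rightDividesʳ)
  open import Algebra.Properties.Semiring.Sum semiring using (sum; sum-syntax; sum-cong-≋; ∑-comm; *-distribˡ-sum)
  import Algebra.Definitions.RawMonoid +-rawMonoid as Mult
  open Complex ℝ

  ≤-isPreorder : IsPreorder _≈_ _≤_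
  ≤-isPreorder = record { isEquivalence = isEquivalence ; reflexive = ≤-reflexive ; trans = ≤-trans }

  ≤-preorder : Preorder _ _ _
  ≤-preorder = record { isPreorder = ≤-isPreorder }

  open import Relation.Binary.Reasoning.Preorder ≤-preorder

  ≤-refl : ∀ {x} → x ≤ x
  ≤-refl = ≤-reflexive refl

  +-mono-≤₂ : ∀ {a b c d} → a ≤ b → c ≤ d → a + c ≤ b + d
  +-mono-≤₂ {a} {b} {c} {d} a≤b c≤d = begin
    a + c  ≲⟨ +-mono-≤ c a≤b ⟩
    b + c  ≈⟨ +-comm b c ⟩
    c + b  ≲⟨ +-mono-≤ b c≤d ⟩
    d + b  ≈⟨ +-comm d b ⟩
    b + d  ∎

  +-cancelʳ-≤ : ∀ {a b} c → a + c ≤ b + c → a ≤ b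
  +-cancelʳ-≤ {a} {b} c a+c≤b+c = begin
    a            ≈⟨ //-rightDividesʳ c a ⟨
    a + c - c    ≲⟨ +-mono-≤ (- c) a+c≤b+c ⟩
    b + c - c    ≈⟨ //-rightDividesʳ c b ⟩
    b            ∎

  x*x-nonneg : ∀ x → 0# ≤ x * x
  x*x-nonneg x with ≤-total 0# x
  ... | inj₁ 0≤x = *-nonneg 0≤x 0≤x
  ... | inj₂ x≤0 = begin
    0#           ≲⟨ *-nonneg 0≤-x 0≤-x ⟩
    - x * - x    ≈⟨ -‿distribˡ-* x (- x) ⟨
    - (x * - x)  ≈⟨ -‿cong (-‿distribʳ-* x x) ⟨
    - - (x * x)  ≈⟨ -‿involutive (x * x) ⟩
    x * x        ∎
    where
    0≤-x : 0# ≤ - x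
    0≤-x = begin
      0#      ≈⟨ -‿inverseʳ x ⟨
      x - x   ≲⟨ +-mono-≤ (- x) x≤0 ⟩
      0# - x  ≈⟨ +-identityˡ (- x) ⟩
      - x     ∎

  0≤1 : 0# ≤ 1#
  0≤1 = ≤-trans (x*x-nonneg 1#) (≤-reflexive (*-identityˡ 1#))

  sum-mono-≤ : ∀ {n} {f g : Fin n → Carrier} → (∀ i → f i ≤ g i) → sum f ≤ sum g
  sum-mono-≤ {zero}  f≤g = ≤-refl
  sum-mono-≤ {suc n} f≤g = +-mono-≤₂ (f≤g zero) (sum-mono-≤ (f≤g ∘ suc))

  fromℕ : ℕ → Carrier
  fromℕ k = k Mult.× 1#

  fromℕ-mono-≤ : ∀ {m n} → m ℕ.≤ n → fromℕ m ≤ fromℕ n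
  fromℕ-mono-≤ {n = zero}  z≤n = ≤-refl
  fromℕ-mono-≤ {n = suc n} z≤n = begin
    0#              ≈⟨ +-identityˡ 0# ⟨
    0# + 0#         ≲⟨ +-mono-≤₂ 0≤1 (fromℕ-mono-≤ {n = n} z≤n) ⟩
    1# + fromℕ n    ∎
  fromℕ-mono-≤ (s≤s m≤n) = +-mono-≤₂ ≤-refl (fromℕ-mono-≤ m≤n)

  fromℕ-suc-≰ : ∀ k → ¬ fromℕ (suc k) ≤ fromℕ k
  fromℕ-suc-≰ k 1+k≤k = 0≉1 (≤-antisym 0≤1 (+-cancelʳ-≤ (fromℕ k) (begin
    1# + fromℕ k   ≲⟨ 1+k≤k ⟩
    fromℕ k        ≈⟨ +-identityˡ (fromℕ k) ⟨
    0# + fromℕ k   ∎)))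

  fromℕ-cancel-≤ : ∀ {m n} → fromℕ m ≤ fromℕ n → m ℕ.≤ n
  fromℕ-cancel-≤ {m} {n} fm≤fn with m ℕₚ.≤? n
  ... | yes m≤n = m≤n
  ... | no  m≰n = contradiction (≤-trans (fromℕ-mono-≤ (ℕₚ.≰⇒> m≰n)) fm≤fn) (fromℕ-suc-≰ n)

  ∣_∣² : ℂ → Carrier
  ∣ a , b ∣² = a * a + b * b

  ∣∣²-nonneg : ∀ z → 0# ≤ ∣ z ∣²
  ∣∣²-nonneg (a , b) = begin
    0#               ≈⟨ +-identityˡ 0# ⟨
    0# + 0#          ≲⟨ +-mono-≤₂ (x*x-nonneg a) (x*x-nonneg b) ⟩
    a * a + b * b    ∎

  ∣∣²-zero : ∀ {z} → z ≈ℂ 0ℂ → ∣ z ∣² ≈ 0#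
  ∣∣²-zero {a , b} (a≈0 , b≈0) = begin-equality
    a * a + b * b      ≈⟨ +-cong (*-cong a≈0 a≈0) (*-cong b≈0 b≈0) ⟩
    0# * 0# + 0# * 0#  ≈⟨ +-cong (zeroˡ 0#) (zeroˡ 0#) ⟩
    0# + 0#            ≈⟨ +-identityˡ 0# ⟩
    0#                 ∎

  re-z*conj-z : ∀ z → proj₁ (z *ℂ conj z) ≈ ∣ z ∣²
  re-z*conj-z (a , b) = +-congˡ (trans (-‿cong (sym (-‿distribʳ-* b b))) (-‿involutive (b * b)))

  re-conj-z*z : ∀ z → proj₁ (conj z *ℂ z) ≈ ∣ z ∣²
  re-conj-z*z (a , b) = +-congˡ (trans (-‿cong (sym (-‿distribˡ-* b b))) (-‿involutive (b * b)))

  re-sumℂ : ∀ n (f : Fin n → ℂ) → proj₁ (sumℂ n f) ≡.≡ sum (proj₁ ∘ f)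
  re-sumℂ zero    f = ≡.refl
  re-sumℂ (suc n) f = ≡.cong (proj₁ (f zero) +_) (re-sumℂ n (f ∘ suc))

  re-I-diag : ∀ {n} (v : Fin n) → proj₁ (I v v) ≡.≡ 1#
  re-I-diag v with v ≟ v
  ... | yes _   = ≡.refl
  ... | no  v≢v = contradiction ≡.refl v≢v

  record IsDoublyStochastic {n} (P : Fin n → Fin n → Carrier) : Set where
    field
      nonneg : ∀ v w → 0# ≤ P v w
      rowSum : ∀ v → ∑[ w < n ] P v w ≈ 1#
      colSum : ∀ w → ∑[ v < n ] P v w ≈ 1#

  unitary⇒doublyStochastic : ∀ {n} {U : Matrix n} → IsUnitary U → IsDoublyStochastic (λ v w → ∣ U v w ∣²)
  unitary⇒doublyStochastic {n} {U} (UU†≈I , U†U≈I) = record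
    { nonneg = λ v w → ∣∣²-nonneg (U v w)
    ; rowSum = λ v → begin-equality
        ∑[ w < n ] ∣ U v w ∣²                  ≈⟨ sum-cong-≋ (λ w → re-z*conj-z (U v w)) ⟨
        ∑[ w < n ] proj₁ (U v w *ℂ (U †) w v)   ≡⟨ re-sumℂ n _ ⟨
        proj₁ ((U · (U †)) v v)                ≈⟨ proj₁ (UU†≈I v v) ⟩
        proj₁ (I v v)                          ≡⟨ re-I-diag v ⟩
        1#                                     ∎
    ; colSum = λ w → begin-equality
        ∑[ v < n ] ∣ U v w ∣²                  ≈⟨ sum-cong-≋ (λ v → re-conj-z*z (U v w)) ⟨
        ∑[ v < n ] proj₁ ((U †) w v *ℂ U v w)   ≡⟨ re-sumℂ n _ ⟨
        proj₁ (((U †) · U) w w)                ≈⟨ proj₁ (U†U≈I w w) ⟩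
        proj₁ (I w w)                          ≡⟨ re-I-diag w ⟩
        1#                                     ∎
    }

  𝟙 : ∀ {n} → Subset n → Fin n → Carrier
  𝟙 S v = if does (v ∈? S) then 1# else 0#

  𝟙-nonneg : ∀ {n} (S : Subset n) v → 0# ≤ 𝟙 S v
  𝟙-nonneg S v with v ∈? S
  ... | yes v∈S = 0≤1
  ... | no  v∉S = ≤-refl

  ∑𝟙≈∣∣ : ∀ {n} (S : Subset n) → ∑[ v < n ] 𝟙 S v ≈ fromℕ ∣ S ∣
  ∑𝟙≈∣∣ []            = refl
  ∑𝟙≈∣∣ (inside  ∷ S) = +-congˡ (∑𝟙≈∣∣ S)
  ∑𝟙≈∣∣ (outside ∷ S) = trans (+-identityˡ _) (∑𝟙≈∣∣ S)

  doublyStochastic⇒∣S∣≤∣T∣ : ∀ {P : Fin n → Fin n → Carrier} → IsDoublyStochastic P →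
                            (∀ {v w} → v ∈ S → w ∉ T → P v w ≈ 0#) → ∣ S ∣ ℕ.≤ ∣ T ∣
  doublyStochastic⇒∣S∣≤∣T∣ {n} {S} {T} {P} P-ds P-vanishes = fromℕ-cancel-≤ (begin
    fromℕ ∣ S ∣                              ≈⟨ ∑𝟙≈∣∣ S ⟨
    ∑[ v < n ] 𝟙 S v                          ≈⟨ sum-cong-≋ (λ v → trans (*-congˡ (rowSum v)) (*-identityʳ _)) ⟨
    ∑[ v < n ] (𝟙 S v * ∑[ w < n ] P v w)      ≈⟨ sum-cong-≋ (λ v → *-distribˡ-sum (𝟙 S v) (P v)) ⟩
    ∑[ v < n ] ∑[ w < n ] (𝟙 S v * P v w)      ≲⟨ sum-mono-≤ (λ v → sum-mono-≤ (𝟙S*P≤𝟙T*P v)) ⟩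
    ∑[ v < n ] ∑[ w < n ] (𝟙 T w * P v w)      ≈⟨ ∑-comm (λ v w → 𝟙 T w * P v w) ⟩
    ∑[ w < n ] ∑[ v < n ] (𝟙 T w * P v w)      ≈⟨ sum-cong-≋ (λ w → *-distribˡ-sum (𝟙 T w) (λ v → P v w)) ⟨
    ∑[ w < n ] (𝟙 T w * ∑[ v < n ] P v w)      ≈⟨ sum-cong-≋ (λ w → trans (*-congˡ (colSum w)) (*-identityʳ _)) ⟩
    ∑[ w < n ] 𝟙 T w                          ≈⟨ ∑𝟙≈∣∣ T ⟩
    fromℕ ∣ T ∣                              ∎)
    where
    open IsDoublyStochastic P-ds
    𝟙S*P≤𝟙T*P : ∀ v w → 𝟙 S v * P v w ≤ 𝟙 T w * P v w
    𝟙S*P≤𝟙T*P v w with v ∈? S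
    ... | no  v∉S = begin
      0# * P v w      ≈⟨ zeroˡ (P v w) ⟩
      0#              ≲⟨ *-nonneg (𝟙-nonneg T w) (nonneg v w) ⟩
      𝟙 T w * P v w   ∎
    ... | yes v∈S with w ∈? T
    ...   | yes w∈T = ≤-refl
    ...   | no  w∉T = begin
      1# * P v w   ≈⟨ *-identityˡ (P v w) ⟩
      P v w        ≈⟨ P-vanishes v∈S w∉T ⟩
      0#           ≈⟨ zeroˡ (P v w) ⟨
      0# * P v w   ∎

  unitary⇒∣S∣≤∣T∣ : ∀ {U : Matrix n} → IsUnitary U → (∀ {v w} → v ∈ S → w ∉ T → U v w ≈ℂ 0ℂ) → ∣ S ∣ ℕ.≤ ∣ T ∣
  unitary⇒∣S∣≤∣T∣ unitary U-vanishes =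
    doublyStochastic⇒∣S∣≤∣T∣ (unitary⇒doublyStochastic unitary) λ v∈S w∉T → ∣∣²-zero (U-vanishes v∈S w∉T)

open import Data.Fin.Subset using (⁅_⁆; ∁; _∪_; _∩_; _─_; _-_; _⊆_; Nonempty; Empty)
open import Data.Fin.Subset.Properties
  using (_⊆?_; ⊆-refl; nonempty?; anySubset?; Empty-unique; p⊆q⇒∣p∣≤∣q∣; ∣p∣≤n; ∣⊥∣≡0; ∣∁p∣≡n∸∣p∣;
         x∈⁅x⁆; x∈⁅y⁆⇒x≡y; ∣⁅x⁆∣≡1; x∈p∪q⁺; x∈p∪q⁻; x∈p∩q⁺; x∈p∩q⁻; p∩q⊆p; p∩q⊆q;
         x∈∁p⇒x∉p; x∉p⇒x∈∁p; p─q⊆p; x∈p∧x≢y⇒x∈p-y; x∈p⇒∣p-x∣<∣p∣)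
open import Algebra.Properties.Monoid.Sum ℕₚ.+-0-monoid using (sum)
open import Data.Nat.Base using (_+_; _*_; _∸_; _≤_; _<_)
open import Data.Nat.Induction using (<-wellFounded)
open import Data.Nat.Properties
  using (_≤?_; ≤-refl; ≤-reflexive; ≤-trans; ≤-antisym; <-irrefl; n<1+n; <⇒≱; ≮⇒≥; m≤m+n; +-suc; +-identityʳ; *-comm;
         m+[n∸m]≡n; +-mono-≤; +-mono-≤-<; +-mono-<-≤; module ≤-Reasoning)
open import Relation.Binary.PropositionalEquality
  using (_≡_; _≢_; refl; sym; trans; subst; cong; cong₂; module ≡-Reasoning)

-- Finite subsets

∈-tabulate⁺ : {f : Fin n → Bool} → f x ≡ true → x ∈ tabulate f
∈-tabulate⁺ {x = x} fx = lookup⇒[]= x _ (trans (lookup∘tabulate _ x) fx)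

∈-tabulate⁻ : {f : Fin n → Bool} → x ∈ tabulate f → f x ≡ true
∈-tabulate⁻ {x = x} x∈ = trans (sym (lookup∘tabulate _ x)) ([]=⇒lookup x∈)

x∈p─q⇒x∉q : ∀ (p q : Subset n) → x ∈ p ─ q → x ∉ q
x∈p─q⇒x∉q (_ ∷ p) (outside ∷ q) (there x∈p─q) (there x∈q) = x∈p─q⇒x∉q p q x∈p─q x∈q
x∈p─q⇒x∉q (_ ∷ p) (inside  ∷ q) (there x∈p─q) (there x∈q) = x∈p─q⇒x∉q p q x∈p─q x∈q

x∈p-y⇒x≢y : ∀ (p : Subset n) → x ∈ p - y → x ≢ y
x∈p-y⇒x≢y {y = y} p x∈p-y refl = x∈p─q⇒x∉q p ⁅ y ⁆ x∈p-y (x∈⁅x⁆ y)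

∣p∪q∣+∣p∩q∣≡∣p∣+∣q∣ : ∀ (p q : Subset n) → ∣ p ∪ q ∣ + ∣ p ∩ q ∣ ≡ ∣ p ∣ + ∣ q ∣
∣p∪q∣+∣p∩q∣≡∣p∣+∣q∣ []            []            = refl
∣p∪q∣+∣p∩q∣≡∣p∣+∣q∣ (inside  ∷ p) (inside  ∷ q) =
  cong suc (trans (+-suc _ _) (trans (cong suc (∣p∪q∣+∣p∩q∣≡∣p∣+∣q∣ p q)) (sym (+-suc _ _))))
∣p∪q∣+∣p∩q∣≡∣p∣+∣q∣ (inside  ∷ p) (outside ∷ q) = cong suc (∣p∪q∣+∣p∩q∣≡∣p∣+∣q∣ p q)
∣p∪q∣+∣p∩q∣≡∣p∣+∣q∣ (outside ∷ p) (inside  ∷ q) = trans (cong suc (∣p∪q∣+∣p∩q∣≡∣p∣+∣q∣ p q)) (sym (+-suc _ _))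
∣p∪q∣+∣p∩q∣≡∣p∣+∣q∣ (outside ∷ p) (outside ∷ q) = ∣p∪q∣+∣p∩q∣≡∣p∣+∣q∣ p q

∣p∪q∣≤∣p∣+∣q∣ : ∀ (p q : Subset n) → ∣ p ∪ q ∣ ≤ ∣ p ∣ + ∣ q ∣
∣p∪q∣≤∣p∣+∣q∣ p q = ≤-trans (m≤m+n _ _) (≤-reflexive (∣p∪q∣+∣p∩q∣≡∣p∣+∣q∣ p q))

p⊆⁅x⁆∪p-x : ∀ (p : Subset n) x → p ⊆ ⁅ x ⁆ ∪ (p - x)
p⊆⁅x⁆∪p-x p x {v} v∈p with v ≟ x
... | yes refl = x∈p∪q⁺ (inj₁ (x∈⁅x⁆ x))
... | no v≢x   = x∈p∪q⁺ (inj₂ (x∈p∧x≢y⇒x∈p-y v∈p v≢x))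

∣p∣≤1+∣p-x∣ : ∀ (p : Subset n) x → ∣ p ∣ ≤ suc ∣ p - x ∣
∣p∣≤1+∣p-x∣ p x = begin
  ∣ p ∣                 ≤⟨ p⊆q⇒∣p∣≤∣q∣ (p⊆⁅x⁆∪p-x p x) ⟩
  ∣ ⁅ x ⁆ ∪ (p - x) ∣   ≤⟨ ∣p∪q∣≤∣p∣+∣q∣ ⁅ x ⁆ (p - x) ⟩
  ∣ ⁅ x ⁆ ∣ + ∣ p - x ∣ ≡⟨ cong (_+ ∣ p - x ∣) (∣⁅x⁆∣≡1 x) ⟩
  suc ∣ p - x ∣         ∎
  where open ≤-Reasoning

0<∣p∣⇒nonempty : ∀ (p : Subset n) → 0 < ∣ p ∣ → Nonempty p
0<∣p∣⇒nonempty (inside  ∷ p) _      = zero , here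
0<∣p∣⇒nonempty (outside ∷ p) 0<∣p∣ = Product.map suc there (0<∣p∣⇒nonempty p 0<∣p∣)

x∈p⇒⁅x⁆⊆p : ∀ {p : Subset n} → x ∈ p → ⁅ x ⁆ ⊆ p
x∈p⇒⁅x⁆⊆p {x = x} {p} x∈p y∈⁅x⁆ = subst (_∈ p) (sym (x∈⁅y⁆⇒x≡y x y∈⁅x⁆)) x∈p

∣⁅x⁆∪⁅y⁆∣≡2 : x ≢ y → ∣ ⁅ x ⁆ ∪ ⁅ y ⁆ ∣ ≡ 2
∣⁅x⁆∪⁅y⁆∣≡2 {n} {x} {y} x≢y = begin
  ∣ ⁅ x ⁆ ∪ ⁅ y ⁆ ∣                       ≡⟨ sym (+-identityʳ _) ⟩
  ∣ ⁅ x ⁆ ∪ ⁅ y ⁆ ∣ + 0                   ≡⟨ cong (∣ ⁅ x ⁆ ∪ ⁅ y ⁆ ∣ +_) ∣⁅x⁆∩⁅y⁆∣≡0 ⟨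
  ∣ ⁅ x ⁆ ∪ ⁅ y ⁆ ∣ + ∣ ⁅ x ⁆ ∩ ⁅ y ⁆ ∣   ≡⟨ ∣p∪q∣+∣p∩q∣≡∣p∣+∣q∣ ⁅ x ⁆ ⁅ y ⁆ ⟩
  ∣ ⁅ x ⁆ ∣ + ∣ ⁅ y ⁆ ∣                   ≡⟨ cong₂ _+_ (∣⁅x⁆∣≡1 x) (∣⁅x⁆∣≡1 y) ⟩
  2                                       ∎
  where
  open ≡-Reasoning
  disjoint : Empty (⁅ x ⁆ ∩ ⁅ y ⁆)
  disjoint (z , z∈⁅x⁆∩⁅y⁆) with z∈⁅x⁆ , z∈⁅y⁆ ← x∈p∩q⁻ ⁅ x ⁆ ⁅ y ⁆ z∈⁅x⁆∩⁅y⁆ =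
    x≢y (trans (sym (x∈⁅y⁆⇒x≡y x z∈⁅x⁆)) (x∈⁅y⁆⇒x≡y y z∈⁅y⁆))
  ∣⁅x⁆∩⁅y⁆∣≡0 : ∣ ⁅ x ⁆ ∩ ⁅ y ⁆ ∣ ≡ 0
  ∣⁅x⁆∩⁅y⁆∣≡0 = trans (cong ∣_∣ (Empty-unique disjoint)) (∣⊥∣≡0 n)

enumerate : (p : Subset n) → Fin ∣ p ∣ → Fin n
enumerate (inside  ∷ p) zero    = zero
enumerate (inside  ∷ p) (suc i) = suc (enumerate p i)
enumerate (outside ∷ p) i       = suc (enumerate p i)

enumerate-∈ : ∀ (p : Subset n) i → enumerate p i ∈ p
enumerate-∈ (inside  ∷ p) zero    = here
enumerate-∈ (inside  ∷ p) (suc i) = there (enumerate-∈ p i)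
enumerate-∈ (outside ∷ p) i       = there (enumerate-∈ p i)

enumerate-injective : ∀ (p : Subset n) {i j} → enumerate p i ≡ enumerate p j → i ≡ j
enumerate-injective (inside  ∷ p) {zero}  {zero}  _ = refl
enumerate-injective (inside  ∷ p) {suc i} {suc j} eq = cong suc (enumerate-injective p (suc-injective eq))
enumerate-injective (outside ∷ p)                 eq = enumerate-injective p (suc-injective eq)

∣∁p∣≡∣p∣⇒∣p∣*2≡n : ∀ (p : Subset n) → ∣ ∁ p ∣ ≡ ∣ p ∣ → ∣ p ∣ * 2 ≡ n
∣∁p∣≡∣p∣⇒∣p∣*2≡n {n} p ∣∁p∣≡∣p∣ = begin
  ∣ p ∣ * 2            ≡⟨ *-comm ∣ p ∣ 2 ⟩
  ∣ p ∣ + (∣ p ∣ + 0)  ≡⟨ cong (∣ p ∣ +_) (+-identityʳ ∣ p ∣) ⟩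
  ∣ p ∣ + ∣ p ∣        ≡⟨ cong (∣ p ∣ +_) ∣∁p∣≡∣p∣ ⟨
  ∣ p ∣ + ∣ ∁ p ∣      ≡⟨ cong (∣ p ∣ +_) (∣∁p∣≡n∸∣p∣ p) ⟩
  ∣ p ∣ + (n ∸ ∣ p ∣)  ≡⟨ m+[n∸m]≡n (∣p∣≤n p) ⟩
  n                    ∎
  where open ≡-Reasoning

-- Hall's theorem

Neighbour : (Fin n → Subset n) → Subset n → Fin n → Set
Neighbour A S w = ∃ λ v → v ∈ S × w ∈ A v

neighbour? : ∀ (A : Fin n → Subset n) S → Decidable (Neighbour A S)
neighbour? A S w = any? λ v → v ∈? S ×-dec w ∈? A v

N : (Fin n → Subset n) → Subset n → Subset n
N A S = tabulate (does ∘ neighbour? A S)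

∈N⁺ : v ∈ S → w ∈ A v → w ∈ N A S
∈N⁺ {v = v} {S = S} {w = w} {A = A} v∈S w∈Av =
  ∈-tabulate⁺ (dec-true (neighbour? A S w) (v , v∈S , w∈Av))

∈N⁻ : w ∈ N A S → Neighbour A S w
∈N⁻ {w = w} {A = A} {S = S} w∈N =
  invert (subst (Reflects _) (∈-tabulate⁻ w∈N) (proof (neighbour? A S w)))

N-mono : S ⊆ T → (∀ {v} → v ∈ S → A v ⊆ B v) → N A S ⊆ N B T
N-mono S⊆T A⊆B w∈N with v , v∈S , w∈Av ← ∈N⁻ w∈N = ∈N⁺ (S⊆T v∈S) (A⊆B v∈S w∈Av)

N-least : (∀ {v} → v ∈ S → A v ⊆ T) → N A S ⊆ T
N-least A⊆T w∈N with v , v∈S , w∈Av ← ∈N⁻ w∈N = A⊆T v∈S w∈Av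

HallCondition : (Fin n → Subset n) → Subset n → Set
HallCondition A L = ∀ {S} → S ⊆ L → ∣ S ∣ ≤ ∣ N A S ∣

record Transversal (A : Fin n → Subset n) (L : Subset n) : Set where
  field
    rep           : Fin n → Fin n
    rep-∈         : ∀ {v} → v ∈ L → rep v ∈ A v
    rep-injective : ∀ {v w} → v ∈ L → w ∈ L → rep v ≡ rep w → v ≡ w

transversal-mono : (∀ {v} → A v ⊆ B v) → Transversal A L → Transversal B L
transversal-mono A⊆B t = record { rep = rep ; rep-∈ = A⊆B ∘ rep-∈ ; rep-injective = rep-injective }
  where open Transversal t

hall⇒nonempty : HallCondition A L → v ∈ L → Nonempty (A v)
hall⇒nonempty {A = A} {v = v} hall v∈L
  with w , w∈N ← 0<∣p∣⇒nonempty (N A ⁅ v ⁆) (subst (_≤ ∣ N A ⁅ v ⁆ ∣) (∣⁅x⁆∣≡1 v) (hall (x∈p⇒⁅x⁆⊆p v∈L)))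
  with v′ , v′∈⁅v⁆ , w∈Av′ ← ∈N⁻ w∈N
  = w , subst (λ u → w ∈ A u) (x∈⁅y⁆⇒x≡y v v′∈⁅v⁆) w∈Av′

Branching : (Fin n → Subset n) → Subset n → Set
Branching A L = ∃ λ x → x ∈ L × ∃₂ λ y₁ y₂ → y₁ ≢ y₂ × y₁ ∈ A x × y₂ ∈ A x

branching? : ∀ (A : Fin n → Subset n) L → Dec (Branching A L)
branching? A L = any? λ x → x ∈? L ×-dec any? λ y₁ → any? λ y₂ →
  ¬? (y₁ ≟ y₂) ×-dec y₁ ∈? A x ×-dec y₂ ∈? A x

unbranched⇒transversal : HallCondition A L → ¬ Branching A L → Transversal A L
unbranched⇒transversal {n} {A} {L} hall unbranched =
  record { rep = rep ; rep-∈ = rep-∈ ; rep-injective = rep-injective }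
  where
  rep : Fin n → Fin n
  rep v with nonempty? (A v)
  ... | yes (y , _) = y
  ... | no _        = v

  rep-∈ : v ∈ L → rep v ∈ A v
  rep-∈ {v} v∈L with nonempty? (A v)
  ... | yes (_ , y∈Av) = y∈Av
  ... | no empty       = contradiction (hall⇒nonempty hall v∈L) empty

  rep-unique : v ∈ L → y ∈ A v → y ∈ ⁅ rep v ⁆
  rep-unique {v} {y} v∈L y∈Av with y ≟ rep v
  ... | yes refl   = x∈⁅x⁆ y
  ... | no y≢rep-v = contradiction (v , v∈L , y , rep v , y≢rep-v , y∈Av , rep-∈ v∈L) unbranched

  rep-injective : v ∈ L → w ∈ L → rep v ≡ rep w → v ≡ w
  rep-injective {v} {w} v∈L w∈L rep-v≡rep-w with v ≟ w
  ... | yes v≡w = v≡w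
  ... | no v≢w  = contradiction (begin-strict
    1                         <⟨ n<1+n 1 ⟩
    2                         ≡⟨ ∣⁅x⁆∪⁅y⁆∣≡2 v≢w ⟨
    ∣ ⁅ v ⁆ ∪ ⁅ w ⁆ ∣         ≤⟨ hall pair⊆L ⟩
    ∣ N A (⁅ v ⁆ ∪ ⁅ w ⁆) ∣   ≤⟨ p⊆q⇒∣p∣≤∣q∣ (N-least single-image) ⟩
    ∣ ⁅ rep v ⁆ ∣             ≡⟨ ∣⁅x⁆∣≡1 (rep v) ⟩
    1                         ∎) (<-irrefl refl)
    where
    open ≤-Reasoning
    pair⊆L : ⁅ v ⁆ ∪ ⁅ w ⁆ ⊆ L
    pair⊆L u∈pair with x∈p∪q⁻ ⁅ v ⁆ ⁅ w ⁆ u∈pair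
    ... | inj₁ u∈⁅v⁆ = x∈p⇒⁅x⁆⊆p v∈L u∈⁅v⁆
    ... | inj₂ u∈⁅w⁆ = x∈p⇒⁅x⁆⊆p w∈L u∈⁅w⁆
    single-image : ∀ {u} → u ∈ ⁅ v ⁆ ∪ ⁅ w ⁆ → A u ⊆ ⁅ rep v ⁆
    single-image u∈pair with x∈p∪q⁻ ⁅ v ⁆ ⁅ w ⁆ u∈pair
    ... | inj₁ u∈⁅v⁆ rewrite x∈⁅y⁆⇒x≡y v u∈⁅v⁆ = rep-unique v∈L
    ... | inj₂ u∈⁅w⁆ rewrite x∈⁅y⁆⇒x≡y w u∈⁅w⁆ | rep-v≡rep-w = rep-unique w∈L

remove : (Fin n → Subset n) → Fin n → Fin n → Fin n → Subset n
remove A x y = updateAt A x (_- y)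

remove-⊆ : ∀ {A : Fin n → Subset n} {x y v} → remove A x y v ⊆ A v
remove-⊆ {A = A} {x} {y} {v} with v ≟ x
... | yes refl rewrite updateAt-updates x {_- y} A = p─q⊆p (A x) ⁅ y ⁆
... | no v≢x   rewrite updateAt-minimal v x {_- y} A v≢x = λ w∈Av → w∈Av

∈-remove-other : v ≢ x → w ∈ A v → w ∈ remove A x y v
∈-remove-other {v = v} {x = x} {A = A} {y = y} v≢x w∈Av =
  subst (_ ∈_) (sym (updateAt-minimal v x {_- y} A v≢x)) w∈Av

∈-remove-self : w ≢ y → w ∈ A x → w ∈ remove A x y x
∈-remove-self {y = y} {A = A} {x = x} w≢y w∈Ax =
  subst (_ ∈_) (sym (updateAt-updates x {_- y} A)) (x∈p∧x≢y⇒x∈p-y w∈Ax w≢y)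

sum-mono-≤ : {f g : Fin n → ℕ} → (∀ i → f i ≤ g i) → sum f ≤ sum g
sum-mono-≤ {zero}  f≤g = z≤n
sum-mono-≤ {suc n} f≤g = +-mono-≤ (f≤g zero) (sum-mono-≤ (f≤g ∘ suc))

sum-mono-< : {f g : Fin n → ℕ} → (∀ i → f i ≤ g i) → f x < g x → sum f < sum g
sum-mono-< {x = zero}  f≤g fx<gx = +-mono-<-≤ fx<gx (sum-mono-≤ (f≤g ∘ suc))
sum-mono-< {x = suc x} f≤g fx<gx = +-mono-≤-< (f≤g zero) (sum-mono-< (f≤g ∘ suc) fx<gx)

size : (Fin n → Subset n) → ℕ
size A = sum (∣_∣ ∘ A)

size-remove : y ∈ A x → size (remove A x y) < size A
size-remove {y = y} {A = A} {x = x} y∈Ax =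
  sum-mono-< {x = x} (λ _ → p⊆q⇒∣p∣≤∣q∣ (remove-⊆ {A = A} {x} {y}))
  (subst (_< ∣ A x ∣) (cong ∣_∣ (sym (updateAt-updates x {_- y} A))) (x∈p⇒∣p-x∣<∣p∣ y∈Ax))

Violator : (Fin n → Subset n) → Subset n → Subset n → Set
Violator A L S = S ⊆ L × ∣ N A S ∣ < ∣ S ∣

violator? : ∀ (A : Fin n → Subset n) L → Decidable (Violator A L)
violator? A L S = S ⊆? L ×-dec suc ∣ N A S ∣ ≤? ∣ S ∣

no-violator⇒hall : ¬ ∃ (Violator A L) → HallCondition A L
no-violator⇒hall none {S} S⊆L = ≮⇒≥ λ short → none (S , S⊆L , short)

violator∋x : HallCondition A L → Violator (remove A x y) L S → x ∈ S
violator∋x {A = A} {x = x} {y = y} {S = S} hall (S⊆L , short) with x ∈? S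
... | yes x∈S = x∈S
... | no  x∉S = contradiction (≤-trans (hall S⊆L) (p⊆q⇒∣p∣≤∣q∣ N⊆)) (<⇒≱ short)
  where
  N⊆ : N A S ⊆ N (remove A x y) S
  N⊆ = N-mono ⊆-refl λ v∈S → ∈-remove-other λ { refl → x∉S v∈S }

violators-clash : ∀ {S₁ S₂} → HallCondition A L → y₁ ≢ y₂ →
                  Violator (remove A x y₁) L S₁ → ¬ Violator (remove A x y₂) L S₂
violators-clash {A = A} {L = L} {y₁ = y₁} {y₂ = y₂} {x = x} {S₁ = S₁} {S₂} hall y₁≢y₂
                viol₁@(S₁⊆L , short₁) viol₂@(S₂⊆L , short₂) =
  <-irrefl refl (begin-strict
    ∣ N₁ ∣ + suc ∣ N₂ ∣                          <⟨ +-mono-<-≤ short₁ short₂ ⟩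
    ∣ S₁ ∣ + ∣ S₂ ∣                              ≡⟨ ∣p∪q∣+∣p∩q∣≡∣p∣+∣q∣ S₁ S₂ ⟨
    ∣ S₁ ∪ S₂ ∣ + ∣ S₁ ∩ S₂ ∣                    ≤⟨ +-mono-≤ (hall ∪⊆L) (∣p∣≤1+∣p-x∣ (S₁ ∩ S₂) x) ⟩
    ∣ N A (S₁ ∪ S₂) ∣ + suc ∣ S₁ ∩ S₂ - x ∣      ≤⟨ +-mono-≤ (p⊆q⇒∣p∣≤∣q∣ N∪⊆) (s≤s (hall -⊆L)) ⟩
    ∣ N₁ ∪ N₂ ∣ + suc ∣ N A (S₁ ∩ S₂ - x) ∣      ≤⟨ +-mono-≤ ≤-refl (s≤s (p⊆q⇒∣p∣≤∣q∣ N∩⊆)) ⟩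
    ∣ N₁ ∪ N₂ ∣ + suc ∣ N₁ ∩ N₂ ∣                ≡⟨ +-suc _ _ ⟩
    suc (∣ N₁ ∪ N₂ ∣ + ∣ N₁ ∩ N₂ ∣)              ≡⟨ cong suc (∣p∪q∣+∣p∩q∣≡∣p∣+∣q∣ N₁ N₂) ⟩
    suc (∣ N₁ ∣ + ∣ N₂ ∣)                        ≡⟨ +-suc _ _ ⟨
    ∣ N₁ ∣ + suc ∣ N₂ ∣                          ∎)
  where
  open ≤-Reasoning
  N₁ = N (remove A x y₁) S₁
  N₂ = N (remove A x y₂) S₂
  x∈S₁ = violator∋x hall viol₁
  x∈S₂ = violator∋x hall viol₂
  ∪⊆L : S₁ ∪ S₂ ⊆ L
  ∪⊆L v∈S₁∪S₂ with x∈p∪q⁻ S₁ S₂ v∈S₁∪S₂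
  ... | inj₁ v∈S₁ = S₁⊆L v∈S₁
  ... | inj₂ v∈S₂ = S₂⊆L v∈S₂
  -⊆L : S₁ ∩ S₂ - x ⊆ L
  -⊆L = S₁⊆L ∘ p∩q⊆p S₁ S₂ ∘ p─q⊆p _ _
  kept : ∀ {v} → v ∈ S₁ ∪ S₂ → A v ⊆ N₁ ∪ N₂
  kept {v} v∈S₁∪S₂ {w} w∈Av with v ≟ x
  ... | no v≢x with x∈p∪q⁻ S₁ S₂ v∈S₁∪S₂
  ...   | inj₁ v∈S₁ = x∈p∪q⁺ (inj₁ (∈N⁺ v∈S₁ (∈-remove-other v≢x w∈Av)))
  ...   | inj₂ v∈S₂ = x∈p∪q⁺ (inj₂ (∈N⁺ v∈S₂ (∈-remove-other v≢x w∈Av)))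
  kept {v} v∈S₁∪S₂ {w} w∈Av | yes refl with w ≟ y₁
  ... | no w≢y₁  = x∈p∪q⁺ (inj₁ (∈N⁺ x∈S₁ (∈-remove-self w≢y₁ w∈Av)))
  ... | yes refl = x∈p∪q⁺ (inj₂ (∈N⁺ x∈S₂ (∈-remove-self y₁≢y₂ w∈Av)))
  N∪⊆ : N A (S₁ ∪ S₂) ⊆ N₁ ∪ N₂
  N∪⊆ = N-least kept
  N∩⊆ : N A (S₁ ∩ S₂ - x) ⊆ N₁ ∩ N₂
  N∩⊆ w∈N = x∈p∩q⁺ (N-mono (p∩q⊆p S₁ S₂ ∘ p─q⊆p _ _) other w∈N , N-mono (p∩q⊆q S₁ S₂ ∘ p─q⊆p _ _) other w∈N)
    where
    other : ∀ {y v} → v ∈ S₁ ∩ S₂ - x → A v ⊆ remove A x y v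
    other v∈ = ∈-remove-other (x∈p-y⇒x≢y (S₁ ∩ S₂) v∈)

hall-remove : HallCondition A L → y₁ ≢ y₂ →
              HallCondition (remove A x y₁) L ⊎ HallCondition (remove A x y₂) L
hall-remove {A = A} {L = L} {y₁ = y₁} {y₂ = y₂} {x = x} hall y₁≢y₂
  with anySubset? (violator? (remove A x y₁) L) | anySubset? (violator? (remove A x y₂) L)
... | no none₁          | _                 = inj₁ (no-violator⇒hall none₁)
... | yes _             | no none₂          = inj₂ (no-violator⇒hall none₂)
... | yes (_ , viol₁)   | yes (_ , viol₂)   = contradiction viol₂ (violators-clash hall y₁≢y₂ viol₁)

hall⇒transversal : HallCondition A L → Transversal A L
hall⇒transversal {A = A} {L} = All.wfRec (On.wellFounded size <-wellFounded) _
  (λ A → HallCondition A L → Transversal A L) step A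
  where
  step : ∀ A → (∀ {B} → size B < size A → HallCondition B L → Transversal B L) →
         HallCondition A L → Transversal A L
  step A rec hallA with branching? A L
  ... | no unbranched = unbranched⇒transversal hallA unbranched
  ... | yes (x , _ , y₁ , y₂ , y₁≢y₂ , y₁∈Ax , y₂∈Ax) with hall-remove {x = x} hallA y₁≢y₂
  ...   | inj₁ hall₁ = transversal-mono (remove-⊆ {A = A}) (rec (size-remove y₁∈Ax) hall₁)
  ...   | inj₂ hall₂ = transversal-mono (remove-⊆ {A = A}) (rec (size-remove y₂∈Ax) hall₂)

-- Perfect matchings of bipartite graphs in 𝒰

outNeighbours : Digraph n → Fin n → Subset n
outNeighbours D v = tabulate (D v)

-- InU only gives ¬ Arc D v w → ¬ ¬ U v w ≈ℂ 0ℂ, and ≈ on the reals need not be stable;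
-- but the conclusion is a decidable inequality of naturals, so we may argue under ¬ ¬.
inU⇒hall : ∀ (ℝ : RealField) {D : Digraph n} → InU ℝ D → ∀ S → ∣ S ∣ ≤ ∣ N (outNeighbours D) S ∣
inU⇒hall ℝ {D} (U , unitary , support) S = decidable-stable (∣ S ∣ ≤? ∣ N (outNeighbours D) S ∣)
  (¬¬-map (λ U-vanishes → unitary⇒∣S∣≤∣T∣ unitary λ v∈S w∉N → U-vanishes _ _ (w∉N ∘ ∈N⁺ v∈S ∘ ∈-tabulate⁺))
          (sequence ¬¬-applicative λ v → sequence ¬¬-applicative λ w → vanishes-off-arcs v w))
  where
  open Complex ℝ
  open DoublyStochastic ℝ using (unitary⇒∣S∣≤∣T∣)
  ¬¬-applicative = RawMonad.rawApplicative ¬¬-Monad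
  vanishes-off-arcs : ∀ v w → ¬ ¬ (¬ Arc D v w → U v w ≈ℂ 0ℂ)
  vanishes-off-arcs v w ¬vanishes =
    ¬vanishes λ ¬arc → contradiction (proj₁ (support v w) λ U≈0 → ¬vanishes λ _ → U≈0) ¬arc

transversal⇒perfectMatching : ∀ {D : Digraph n} L → N (outNeighbours D) L ⊆ ∁ L → ∣ L ∣ * 2 ≡ n →
                              Transversal (outNeighbours D) L → HasPerfectMatching D
transversal⇒perfectMatching {D = D} L N⊆∁L ∣L∣*2≡n t = ∣ L ∣ , ∣L∣*2≡n , M , M-edge , M-disjoint
  where
  open Transversal t
  e = enumerate L
  e∈L = enumerate-∈ L
  M : Fin ∣ L ∣ → Fin _ × Fin _
  M i = e i , rep (e i)
  arc : ∀ i → Arc D (e i) (rep (e i))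
  arc i = ∈-tabulate⁻ (rep-∈ (e∈L i))
  rep∉L : ∀ i → rep (e i) ∉ L
  rep∉L i = x∈∁p⇒x∉p (N⊆∁L (∈N⁺ (e∈L i) (rep-∈ (e∈L i))))
  M-edge : ∀ i → e i ≢ rep (e i) × Arc D (e i) (rep (e i))
  M-edge i = (λ eq → rep∉L i (subst (_∈ L) eq (e∈L i))) , arc i
  M-disjoint : ∀ i j → i ≢ j → Disjoint (M i) (M j)
  M-disjoint i j i≢j =
      i≢j ∘ enumerate-injective L
    , (λ eq → rep∉L j (subst (_∈ L) eq (e∈L i)))
    , (λ eq → rep∉L i (subst (_∈ L) (sym eq) (e∈L j)))
    , i≢j ∘ enumerate-injective L ∘ rep-injective (e∈L i) (e∈L j)

bipartite-hall⇒perfectMatching : ∀ {D : Digraph n} → IsBipartite D →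
                                 (∀ S → ∣ S ∣ ≤ ∣ N (outNeighbours D) S ∣) → HasPerfectMatching D
bipartite-hall⇒perfectMatching {D = D} (c , proper) expands =
  transversal⇒perfectMatching X NX⊆∁X (∣∁p∣≡∣p∣⇒∣p∣*2≡n X ∣∁X∣≡∣X∣) (hall⇒transversal λ {S} _ → expands S)
  where
  X = tabulate c
  crosses : ∀ {v w} → Arc D v w → c w ≡ not (c v)
  crosses {v} {w} arc = ¬-not (proper v w arc ∘ sym)
  NX⊆∁X : N (outNeighbours D) X ⊆ ∁ X
  NX⊆∁X w∈N with v , v∈X , w∈Dv ← ∈N⁻ w∈N = x∉p⇒x∈∁p λ w∈X →
    proper v _ (∈-tabulate⁻ w∈Dv) (trans (∈-tabulate⁻ v∈X) (sym (∈-tabulate⁻ w∈X)))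
  N∁X⊆X : N (outNeighbours D) (∁ X) ⊆ X
  N∁X⊆X w∈N with v , v∈∁X , w∈Dv ← ∈N⁻ w∈N =
    ∈-tabulate⁺ (trans (crosses (∈-tabulate⁻ w∈Dv)) (cong not (¬-not (x∈∁p⇒x∉p v∈∁X ∘ ∈-tabulate⁺))))
  ∣∁X∣≡∣X∣ : ∣ ∁ X ∣ ≡ ∣ X ∣
  ∣∁X∣≡∣X∣ = ≤-antisym (≤-trans (expands (∁ X)) (p⊆q⇒∣p∣≤∣q∣ N∁X⊆X))
                       (≤-trans (expands X) (p⊆q⇒∣p∣≤∣q∣ NX⊆∁X))

mainTheorem12 : (ℝ : RealField) → (n : ℕ) → (D : Digraph n) →
                IsSymmetric D → IsBipartite D → InU ℝ D → HasPerfectMatching D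
mainTheorem12 ℝ n D _ bipartite inU =
  bipartite-hall⇒perfectMatching bipartite (inU⇒hall ℝ inU)
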